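{- Let $q\ge5$ be prime, $q^*=(-1)^{(q-1)/2}q$, $u_q(j)=(3^j-q^*(-1)^j)/4$, and let $D_q(n)$ be the smallest positive integer $m$ such that $u_q(1),\ldots,u_q(n)$ are pairwise incongruent modulo $m$. Then $3\nmid D_q(n)$ for every $n\ge1$. -}

module Defs where

open import Data.Nat as ℕ using (ℕ; suc; _≤_; _<_)
open import Data.Nat.Divisibility as ℕD using ()
open import Data.Integer as ℤ using (ℤ; +_; -_; _-_; _*_; _^_)
open import Data.Integer.DivMod using (_/ℕ_)
open import Data.Integer.Divisibility using (_∣_)
open import Relation.Nullary using (¬_)
open import Data.Product using (_×_)

qStar : ℕ → ℤ
qStar q = (- ℤ.1ℤ) ^ ((q ℕ.∸ 1) ℕ./ 2) * + q

-- u_q(j) = (3^j - q*(-1)^j)/4   (the division is exact for odd primes q)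
u : ℕ → ℕ → ℤ
u q j = ((+ 3) ^ j - qStar q * (- ℤ.1ℤ) ^ j) /ℕ 4

Separates : ℕ → ℕ → ℕ → Set
Separates q n m = ∀ i j → 1 ≤ i → i < j → j ≤ n → ¬ ((+ m) ∣ (u q i - u q j))

IsD : ℕ → ℕ → ℕ → Set
IsD q n m = (1 ≤ m) × Separates q n m × (∀ k → 1 ≤ k → Separates q n k → m ≤ k)

{-# OPTIONS --safe #-}
module Submission where

-- Exact division by 4 turns the definition of u into the recurrence u(j) + u(j+1) = 3^j, which
-- only needs q* ≡ 1 (mod 4).  Hence u(i+2t) − u(i) = 2·3^i·R(t) with R(t) = (9^t − 1)/8, while
-- u(i) − u(i+1+2t) is odd.  If 3 ∤ k, every pair separated by 3k is then separated by 2k, so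
-- D cannot be 3k.  If D = 9l: since v₂(R(t)) = v₂(t), the power of two 2^(b+1) ∈ [n, 2n]
-- separates, so 9l ≤ 2n; but the ⌊n/2⌋ values u(2+2s) = u(2) + 18·R(s) are pairwise incongruent
-- modulo 9l, so by pigeonhole on R(s) mod l we get l ≥ ⌊n/2⌋, and 9l ≤ 2n ≤ 4l + 2 is absurd.

open import Defs
open import Data.Nat
open import Data.Nat.Properties
open import Data.Nat.Divisibility
open import Data.Nat.DivMod using (m*n/n≡m; m≡m%n+[m/n]*n; m%n<n)
open import Data.Nat.Primality using (Prime; composite; euclidsLemma; prime⇒nonZero; prime?; prime[2]; ¬prime[1])
open import Data.Nat.Tactic.RingSolver using (solve-∀)
open import Data.Integer as ℤ using (ℤ; +_; ∣_∣; 1ℤ)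
open import Data.Integer.DivMod using (_/ℕ_; _%ℕ_; a≡a%ℕn+[a/ℕn]*n; n%ℕd<d)
import Data.Integer.Properties as ℤ
import Data.Integer.Divisibility.Signed as ℤˢ
import Data.Integer.Tactic.RingSolver as ℤ
open import Data.Fin using (toℕ; fromℕ<)
open import Data.Fin.Properties using (pigeonhole; toℕ<n; fromℕ<-injective)
open import Data.Product using (∃₂; ∃-syntax; _×_; _,_)
open import Data.Sum using (_⊎_; inj₁; inj₂; [_,_])
open import Relation.Nullary using (¬_; contradiction; yes; no)
open import Relation.Nullary.Decidable using (toWitness)
open import Relation.Binary.PropositionalEquality hiding ([_])

prime[3] : Prime 3
prime[3] = toWitness {a? = prime? 3} _

module _ {p} (p-prime : Prime p) where

  private instance
    p≢0 : NonZero p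
    p≢0 = prime⇒nonZero p-prime

  ∤⇒∤^ : ∀ {m} → ¬ p ∣ m → ∀ n → ¬ p ∣ m ^ n
  ∤⇒∤^ p∤m zero    p∣1    = ¬prime[1] (subst Prime (∣1⇒≡1 p∣1) p-prime)
  ∤⇒∤^ p∤m (suc n) p∣m^sn = [ p∤m , ∤⇒∤^ p∤m n ] (euclidsLemma _ _ p-prime p∣m^sn)

  p^k∣o*y⇒p^k∣y : ∀ {o} → ¬ p ∣ o → ∀ k {y} → p ^ k ∣ o * y → p ^ k ∣ y
  p^k∣o*y⇒p^k∣y p∤o zero    {y} _ = 1∣ y
  p^k∣o*y⇒p^k∣y {o} p∤o (suc k) {y} p^[1+k]∣oy
    with euclidsLemma o y p-prime (∣-trans (m∣m*n (p ^ k)) p^[1+k]∣oy)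
  ... | inj₁ p∣o = contradiction p∣o p∤o
  ... | inj₂ (divides y′ refl) = subst (p ^ suc k ∣_) (*-comm p y′) (*-monoʳ-∣ p (p^k∣o*y⇒p^k∣y p∤o k p^k∣oy′))
    where
    p^k∣oy′ : p ^ k ∣ o * y′
    p^k∣oy′ = *-cancelˡ-∣ p (subst (p ^ suc k ∣_) (pull o y′ p) p^[1+k]∣oy)
      where
      pull : ∀ o y p → o * (y * p) ≡ p * (o * y)
      pull = solve-∀

  p∣y∧k∣y⇒p*k∣y : ∀ {k y} → ¬ p ∣ k → p ∣ y → k ∣ y → p * k ∣ y
  p∣y∧k∣y⇒p*k∣y {k} p∤k p∣y (divides z refl) with euclidsLemma z k p-prime p∣y
  ... | inj₁ (divides w refl) = divides w (*-assoc w p k)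
  ... | inj₂ p∣k              = contradiction p∣k p∤k

2∤1+2n : ∀ n → ¬ 2 ∣ 1 + 2 * n
2∤1+2n n 2∣1+2n = contradiction (∣1⇒≡1 (∣m+n∣m⇒∣n (subst (2 ∣_) (+-comm 1 (2 * n)) 2∣1+2n) (m∣m*n n))) λ ()

even-or-odd : ∀ n → ∃[ h ] (n ≡ 2 * h ⊎ n ≡ 1 + 2 * h)
even-or-odd zero = 0 , inj₁ refl
even-or-odd (suc n) with even-or-odd n
... | h , inj₁ refl = h , inj₂ refl
... | h , inj₂ refl = suc h , inj₁ (sym (*-suc 2 h))

gap-parity : ∀ {i j} → i < j → (∃[ t ] (1 ≤ t × j ≡ i + 2 * t)) ⊎ (∃[ t ] j ≡ suc i + 2 * t)
gap-parity {i} i<j with m≤n⇒∃[o]m+o≡n i<j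
... | d , refl with even-or-odd d
...   | h , inj₁ refl = inj₂ (h , refl)
...   | h , inj₂ refl = inj₁ (suc h , s≤s z≤n , shift i h)
  where
  shift : ∀ i h → suc i + (1 + 2 * h) ≡ i + 2 * suc h
  shift = solve-∀

power-of-two-between : ∀ n → ∃[ b ] (suc n ≤ 2 * 2 ^ b × 2 ^ b ≤ suc n)
power-of-two-between zero = 0 , s≤s z≤n , ≤-refl
power-of-two-between (suc n) with power-of-two-between n
... | b , 1+n≤2^[1+b] , 2^b≤1+n with suc (suc n) ≤? 2 * 2 ^ b
...   | yes 2+n≤2^[1+b] = b , 2+n≤2^[1+b] , m≤n⇒m≤1+n 2^b≤1+n
...   | no  2+n≰2^[1+b] = suc b , 2+n≤2^[2+b] , 2^[1+b]≤2+n
  where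
  open ≤-Reasoning
  2^[1+b]≡1+n : 2 * 2 ^ b ≡ suc n
  2^[1+b]≡1+n = ≤-antisym (≤-pred (≰⇒> 2+n≰2^[1+b])) 1+n≤2^[1+b]
  2+n≤2^[2+b] : suc (suc n) ≤ 2 * (2 * 2 ^ b)
  2+n≤2^[2+b] = begin
    1 + suc n      ≤⟨ +-monoˡ-≤ (suc n) (s≤s z≤n) ⟩
    suc n + suc n  ≡⟨ cong (λ m → suc n + m) (+-identityʳ (suc n)) ⟨
    2 * suc n      ≡⟨ cong (2 *_) 2^[1+b]≡1+n ⟨
    2 * (2 * 2 ^ b) ∎
  2^[1+b]≤2+n : 2 * 2 ^ b ≤ suc (suc n)
  2^[1+b]≤2+n = begin
    2 * 2 ^ b   ≡⟨ 2^[1+b]≡1+n ⟩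
    suc n       ≤⟨ n≤1+n (suc n) ⟩
    suc (suc n) ∎

halve : ∀ n → ∃[ h ] (2 * h ≤ n × n ≤ 1 + 2 * h)
halve n with even-or-odd n
... | h , inj₁ refl = h , ≤-refl , n≤1+n (2 * h)
... | h , inj₂ refl = h , n≤1+n (2 * h) , ≤-refl

2[1+2l]<9l : ∀ l .{{_ : NonZero l}} → 2 * (1 + 2 * l) < 9 * l
2[1+2l]<9l (suc l) = subst₂ _<_ (sym (expand₁ l)) (sym (expand₂ l)) (+-mono-<-≤ (m<m+n 6 {3} z<s) 4l≤9l)
  where
  4l≤9l : 4 * l ≤ 9 * l
  4l≤9l = *-monoˡ-≤ l (m≤m+n 4 5)
  expand₁ : ∀ l → 2 * (1 + 2 * suc l) ≡ 6 + 4 * l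
  expand₁ = solve-∀
  expand₂ : ∀ l → 9 * suc l ≡ 9 + 9 * l
  expand₂ = solve-∀

%≡%⇒∣∸ : ∀ d .{{_ : NonZero d}} {m n} → m % d ≡ n % d → d ∣ n ∸ m
%≡%⇒∣∸ d {m} {n} m%d≡n%d = divides (n / d ∸ m / d) (begin
  n ∸ m                                   ≡⟨ cong₂ _∸_ (m≡m%n+[m/n]*n n d) (m≡m%n+[m/n]*n m d) ⟩
  (n % d + n / d * d) ∸ (m % d + m / d * d) ≡⟨ cong (λ r → (n % d + n / d * d) ∸ (r + m / d * d)) m%d≡n%d ⟩
  (n % d + n / d * d) ∸ (n % d + m / d * d) ≡⟨ [m+n]∸[m+o]≡n∸o (n % d) _ _ ⟩
  n / d * d ∸ m / d * d                   ≡⟨ *-distribʳ-∸ d (n / d) (m / d) ⟨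
  (n / d ∸ m / d) * d                     ∎)
  where open ≡-Reasoning

pigeonhole-% : ∀ d .{{_ : NonZero d}} {K} (f : ℕ → ℕ) → d < K →
               ∃₂ λ s s′ → s < s′ × s′ < K × f s % d ≡ f s′ % d
pigeonhole-% d f d<K with pigeonhole d<K (λ s → fromℕ< (m%n<n (f (toℕ s)) d))
... | s , s′ , s<s′ , eq = toℕ s , toℕ s′ , s<s′ , toℕ<n s′ , fromℕ<-injective _ _ _ _ eq

repunit : ℕ → ℕ → ℕ
repunit b zero    = 0
repunit b (suc t) = 1 + b * repunit b t

repunit-mono-≤ : ∀ b {s t} → s ≤ t → repunit b s ≤ repunit b t
repunit-mono-≤ b {zero} _         = z≤n
repunit-mono-≤ b        (s≤s s≤t) = +-monoʳ-≤ 1 (*-monoʳ-≤ b (repunit-mono-≤ b s≤t))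

module _ (c : ℕ) where

  private
    R : ℕ → ℕ
    R = repunit (1 + 4 * c)

  repunit-+ : ∀ s t → R (s + t) ≡ R t + (1 + 4 * c * R t) * R s
  repunit-+ zero    t = sym (trans (cong (λ r → R t + r) (*-zeroʳ (1 + 4 * c * R t))) (+-identityʳ (R t)))
  repunit-+ (suc s) t = trans (cong (λ r → 1 + (1 + 4 * c) * r) (repunit-+ s t)) (step c (R s) (R t))
    where
    step : ∀ c a b → 1 + (1 + 4 * c) * (b + (1 + 4 * c * b) * a) ≡ b + (1 + 4 * c * b) * (1 + (1 + 4 * c) * a)
    step = solve-∀

  repunit-double : ∀ t → R (t * 2) ≡ 2 * ((1 + 2 * (c * R t)) * R t)
  repunit-double t = begin
    R (t * 2)                     ≡⟨ cong R (*-comm t 2) ⟩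
    R (t + (t + 0))               ≡⟨ cong (λ s → R (t + s)) (+-identityʳ t) ⟩
    R (t + t)                     ≡⟨ repunit-+ t t ⟩
    R t + (1 + 4 * c * R t) * R t ≡⟨ factor c (R t) ⟩
    2 * ((1 + 2 * (c * R t)) * R t) ∎
    where
    open ≡-Reasoning
    factor : ∀ c a → a + (1 + 4 * c * a) * a ≡ 2 * ((1 + 2 * (c * a)) * a)
    factor = solve-∀

  repunit≡id-mod-2 : ∀ t → 2 ∣ R t + t
  repunit≡id-mod-2 zero    = divides 0 refl
  repunit≡id-mod-2 (suc t) =
    subst (2 ∣_) (regroup c (R t) t) (∣m∣n⇒∣m+n (m∣m*n (1 + 2 * (c * R t))) (repunit≡id-mod-2 t))
    where
    regroup : ∀ c a t → 2 * (1 + 2 * (c * a)) + (a + t) ≡ 1 + (1 + 4 * c) * a + suc t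
    regroup = solve-∀

  -- R t ≡ t (mod 2) makes t = 2s even, and R (2s) = 2·(odd)·R s lets the 2-adic valuation descend.
  2^k∣repunit⇒2^k∣t : ∀ k t → 2 ^ k ∣ R t → 2 ^ k ∣ t
  2^k∣repunit⇒2^k∣t zero    t _ = 1∣ t
  2^k∣repunit⇒2^k∣t (suc k) t 2^[1+k]∣Rt
    with ∣m+n∣m⇒∣n (repunit≡id-mod-2 t) (∣-trans (m∣m*n (2 ^ k)) 2^[1+k]∣Rt)
  ... | divides s refl = subst (2 ^ suc k ∣_) (*-comm 2 s) (*-monoʳ-∣ 2 (2^k∣repunit⇒2^k∣t k s 2^k∣Rs))
    where
    2^k∣Rs : 2 ^ k ∣ R s
    2^k∣Rs = p^k∣o*y⇒p^k∣y prime[2] (2∤1+2n (c * R s)) k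
             (*-cancelˡ-∣ 2 (subst (2 ^ suc k ∣_) (repunit-double s) 2^[1+k]∣Rt))

i*n/ℕn≡i : ∀ i n .{{_ : NonZero n}} → (i ℤ.* + n) /ℕ n ≡ i
i*n/ℕn≡i i n = sym (ℤ.i-j≡0⇒i≡j i q (ℤ.∣i∣≡0⇒i≡0 (n<1⇒n≡0 ∣i-q∣<1)))
  where
  q : ℤ
  q = (i ℤ.* + n) /ℕ n
  r : ℕ
  r = (i ℤ.* + n) %ℕ n
  +r≡[i-q]*n : + r ≡ (i ℤ.- q) ℤ.* + n
  +r≡[i-q]*n = begin
    + r                                  ≡⟨ isolate (+ r) i q (+ n) ⟩
    (+ r ℤ.+ q ℤ.* + n) ℤ.- q ℤ.* + n    ≡⟨ cong (ℤ._- q ℤ.* + n) (a≡a%ℕn+[a/ℕn]*n (i ℤ.* + n) n) ⟨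
    i ℤ.* + n ℤ.- q ℤ.* + n              ≡⟨ factor i q (+ n) ⟩
    (i ℤ.- q) ℤ.* + n                    ∎
    where
    open ≡-Reasoning
    isolate : ∀ r i q n → r ≡ (r ℤ.+ q ℤ.* n) ℤ.- q ℤ.* n
    isolate = ℤ.solve-∀
    factor : ∀ i q n → i ℤ.* n ℤ.- q ℤ.* n ≡ (i ℤ.- q) ℤ.* n
    factor = ℤ.solve-∀
  ∣i-q∣<1 : ∣ i ℤ.- q ∣ < 1
  ∣i-q∣<1 = *-cancelʳ-< _ _ _ (subst₂ _<_ r≡∣i-q∣*n (sym (*-identityˡ n)) (n%ℕd<d (i ℤ.* + n) n))
    where
    r≡∣i-q∣*n : r ≡ ∣ i ℤ.- q ∣ * n
    r≡∣i-q∣*n = trans (cong ∣_∣ +r≡[i-q]*n) (ℤ.abs-* (i ℤ.- q) (+ n))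

[i/ℕn]*n≡i : ∀ {i} n .{{_ : NonZero n}} → + n ℤˢ.∣ i → (i /ℕ n) ℤ.* + n ≡ i
[i/ℕn]*n≡i n (ℤˢ.divides k refl) = cong (ℤ._* + n) (i*n/ℕn≡i k n)

pos-^ : ∀ m n → + (m ^ n) ≡ (+ m) ℤ.^ n
pos-^ m zero    = refl
pos-^ m (suc n) = trans (ℤ.pos-* m (m ^ n)) (cong (+ m ℤ.*_) (pos-^ m n))

-- Separates q n m unfolds to Incongruent (u q) n m.
Incongruent : (ℕ → ℤ) → ℕ → ℕ → Set
Incongruent x n m = ∀ i j → 1 ≤ i → i < j → j ≤ n → ¬ m ∣ ∣ x i ℤ.- x j ∣

module _ {x : ℕ → ℤ} (x-step : ∀ i → x i ℤ.+ x (suc i) ≡ + (3 ^ i)) where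

  x[2+i]≡x[i]+2*3^i : ∀ i → x (2 + i) ≡ x i ℤ.+ + (2 * 3 ^ i)
  x[2+i]≡x[i]+2*3^i i = begin
    x (2 + i)                                                  ≡⟨ telescope (x i) (x (1 + i)) (x (2 + i)) ⟩
    (x (1 + i) ℤ.+ x (2 + i)) ℤ.- (x i ℤ.+ x (1 + i)) ℤ.+ x i ≡⟨ cong₂ (λ a b → a ℤ.- b ℤ.+ x i) (x-step (1 + i)) (x-step i) ⟩
    + (3 * 3 ^ i) ℤ.- + (3 ^ i) ℤ.+ x i                        ≡⟨ cong (λ a → a ℤ.- + (3 ^ i) ℤ.+ x i) (ℤ.pos-* 3 (3 ^ i)) ⟩
    + 3 ℤ.* + (3 ^ i) ℤ.- + (3 ^ i) ℤ.+ x i                    ≡⟨ collect (x i) (+ (3 ^ i)) ⟩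
    x i ℤ.+ + 2 ℤ.* + (3 ^ i)                                  ≡⟨ cong (λ a → x i ℤ.+ a) (ℤ.pos-* 2 (3 ^ i)) ⟨
    x i ℤ.+ + (2 * 3 ^ i)                                      ∎
    where
    open ≡-Reasoning
    telescope : ∀ a b c → c ≡ (b ℤ.+ c) ℤ.- (a ℤ.+ b) ℤ.+ a
    telescope = ℤ.solve-∀
    collect : ∀ a p → + 3 ℤ.* p ℤ.- p ℤ.+ a ≡ a ℤ.+ + 2 ℤ.* p
    collect = ℤ.solve-∀

  x[i+2t]≡x[i]+2*3^i*R[t] : ∀ i t → x (i + 2 * t) ≡ x i ℤ.+ + (2 * 3 ^ i * repunit 9 t)
  x[i+2t]≡x[i]+2*3^i*R[t] i zero = begin
    x (i + 0)                 ≡⟨ cong x (+-identityʳ i) ⟩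
    x i                       ≡⟨ ℤ.+-identityʳ (x i) ⟨
    x i ℤ.+ + 0               ≡⟨ cong (λ k → x i ℤ.+ + k) (*-zeroʳ (2 * 3 ^ i)) ⟨
    x i ℤ.+ + (2 * 3 ^ i * 0) ∎
    where open ≡-Reasoning
  x[i+2t]≡x[i]+2*3^i*R[t] i (suc t) = begin
    x (i + 2 * suc t)                                              ≡⟨ cong x (shift i t) ⟩
    x ((2 + i) + 2 * t)                                            ≡⟨ x[i+2t]≡x[i]+2*3^i*R[t] (2 + i) t ⟩
    x (2 + i) ℤ.+ + (2 * 3 ^ (2 + i) * R t)                        ≡⟨ cong (λ a → a ℤ.+ + (2 * 3 ^ (2 + i) * R t)) (x[2+i]≡x[i]+2*3^i i) ⟩
    x i ℤ.+ + (2 * 3 ^ i) ℤ.+ + (2 * 3 ^ (2 + i) * R t)            ≡⟨ ℤ.+-assoc (x i) _ _ ⟩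
    x i ℤ.+ (+ (2 * 3 ^ i) ℤ.+ + (2 * 3 ^ (2 + i) * R t))          ≡⟨ cong (λ a → x i ℤ.+ a) (ℤ.pos-+ (2 * 3 ^ i) _) ⟨
    x i ℤ.+ + (2 * 3 ^ i + 2 * 3 ^ (2 + i) * R t)                  ≡⟨ cong (λ k → x i ℤ.+ + k) (collect (3 ^ i) (R t)) ⟩
    x i ℤ.+ + (2 * 3 ^ i * R (suc t))                              ∎
    where
    open ≡-Reasoning
    R : ℕ → ℕ
    R = repunit 9
    shift : ∀ i t → i + 2 * suc t ≡ (2 + i) + 2 * t
    shift = solve-∀
    collect : ∀ p r → 2 * p + 2 * (3 * (3 * p)) * r ≡ 2 * p * (1 + 9 * r)
    collect = solve-∀

  ∣x[i]-x[i+2t]∣≡2*3^i*R[t] : ∀ i t → ∣ x i ℤ.- x (i + 2 * t) ∣ ≡ 2 * 3 ^ i * repunit 9 t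
  ∣x[i]-x[i+2t]∣≡2*3^i*R[t] i t = begin
    ∣ x i ℤ.- x (i + 2 * t) ∣        ≡⟨ cong (λ a → ∣ x i ℤ.- a ∣) (x[i+2t]≡x[i]+2*3^i*R[t] i t) ⟩
    ∣ x i ℤ.- (x i ℤ.+ + N) ∣        ≡⟨ cong ∣_∣ (cancel (x i) (+ N)) ⟩
    ∣ ℤ.- + N ∣                      ≡⟨ ℤ.∣-i∣≡∣i∣ (+ N) ⟩
    N                                ∎
    where
    open ≡-Reasoning
    N : ℕ
    N = 2 * 3 ^ i * repunit 9 t
    cancel : ∀ a n → a ℤ.- (a ℤ.+ n) ≡ ℤ.- n
    cancel = ℤ.solve-∀

  -- The odd gap differs from the odd number 3^i by an even number, since x i + x (1 + i) = 3^i.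
  2∤x[i]-x[1+i+2t] : ∀ i t → ¬ 2 ∣ ∣ x i ℤ.- x (suc i + 2 * t) ∣
  2∤x[i]-x[1+i+2t] i t 2∣d = ∤⇒∤^ prime[2] (2∤1+2n 1) i
    (ℤˢ.∣⇒∣ᵤ (subst (+ 2 ℤˢ.∣_) (sym 3^i≡2y-d) (ℤˢ.∣m∣n⇒∣m-n (ℤˢ.∣m⇒∣m*n y ℤˢ.∣-refl) (ℤˢ.∣ᵤ⇒∣ 2∣d))))
    where
    open ≡-Reasoning
    M : ℕ
    M = 3 ^ suc i * repunit 9 t
    y : ℤ
    y = x i ℤ.- + M
    d : ℤ
    d = x i ℤ.- x (suc i + 2 * t)
    regroup : ∀ a b m → a ℤ.+ b ≡ + 2 ℤ.* (a ℤ.- m) ℤ.- (a ℤ.- (b ℤ.+ + 2 ℤ.* m))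
    regroup = ℤ.solve-∀
    3^i≡2y-d : + (3 ^ i) ≡ + 2 ℤ.* y ℤ.- d
    3^i≡2y-d = begin
      + (3 ^ i)                                                         ≡⟨ x-step i ⟨
      x i ℤ.+ x (suc i)                                                 ≡⟨ regroup (x i) (x (suc i)) (+ M) ⟩
      + 2 ℤ.* y ℤ.- (x i ℤ.- (x (suc i) ℤ.+ + 2 ℤ.* + M))              ≡⟨ cong (λ a → + 2 ℤ.* y ℤ.- (x i ℤ.- (x (suc i) ℤ.+ a))) 2M≡ ⟩
      + 2 ℤ.* y ℤ.- (x i ℤ.- (x (suc i) ℤ.+ + (2 * 3 ^ suc i * repunit 9 t))) ≡⟨ cong (λ a → + 2 ℤ.* y ℤ.- (x i ℤ.- a)) (x[i+2t]≡x[i]+2*3^i*R[t] (suc i) t) ⟨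
      + 2 ℤ.* y ℤ.- d                                                   ∎
      where
      2M≡ : + 2 ℤ.* + M ≡ + (2 * 3 ^ suc i * repunit 9 t)
      2M≡ = trans (sym (ℤ.pos-* 2 M)) (cong +_ (sym (*-assoc 2 (3 ^ suc i) (repunit 9 t))))

  incongruent-if-even-gaps : ∀ {n m} → 2 ∣ m →
    (∀ i t → 1 ≤ i → 1 ≤ t → i + 2 * t ≤ n → ¬ m ∣ 2 * 3 ^ i * repunit 9 t) → Incongruent x n m
  incongruent-if-even-gaps {m = m} 2∣m even-gap i j 1≤i i<j j≤n m∣d with gap-parity i<j
  ... | inj₁ (t , 1≤t , refl) = even-gap i t 1≤i 1≤t j≤n (subst (m ∣_) (∣x[i]-x[i+2t]∣≡2*3^i*R[t] i t) m∣d)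
  ... | inj₂ (t , refl)       = 2∤x[i]-x[1+i+2t] i t (∣-trans 2∣m m∣d)

  -- 2^(1+b) ∣ 2·3^i·R t would give 2^b ∣ R t, hence 2^b ∣ t, against 2t < n ≤ 2^(1+b).
  incongruent-2*2^b : ∀ {n} b → n ≤ 2 * 2 ^ b → Incongruent x n (2 * 2 ^ b)
  incongruent-2*2^b {n} b n≤2^[1+b] = incongruent-if-even-gaps (m∣m*n (2 ^ b)) λ i t 1≤i 1≤t i+2t≤n 2^[1+b]∣gap →
    let 2^b∣t : 2 ^ b ∣ t
        2^b∣t = 2^k∣repunit⇒2^k∣t 2 b t (p^k∣o*y⇒p^k∣y prime[2] (∤⇒∤^ prime[2] (2∤1+2n 1) i) b
                  (*-cancelˡ-∣ 2 (subst (2 * 2 ^ b ∣_) (*-assoc 2 (3 ^ i) (repunit 9 t)) 2^[1+b]∣gap)))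
        2t<2^[1+b] : 2 * t < 2 * 2 ^ b
        2t<2^[1+b] = <-≤-trans (m<n+m (2 * t) 1≤i) (≤-trans i+2t≤n n≤2^[1+b])
    in <⇒≱ 2t<2^[1+b] (*-monoʳ-≤ 2 (∣⇒≤ {{>-nonZero 1≤t}} 2^b∣t))

  incongruent-3*⇒incongruent-2* : ∀ {n k} → ¬ 3 ∣ k → Incongruent x n (3 * k) → Incongruent x n (2 * k)
  incongruent-3*⇒incongruent-2* {k = k} 3∤k incongruent-3k = incongruent-if-even-gaps (m∣m*n k) λ i t 1≤i 1≤t i+2t≤n 2k∣gap →
    incongruent-3k i (i + 2 * t) 1≤i (m<m+n i (≤-trans 1≤t (m≤m+n t (t + 0)))) i+2t≤n
      (subst (3 * k ∣_) (sym (∣x[i]-x[i+2t]∣≡2*3^i*R[t] i t))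
        (p∣y∧k∣y⇒p*k∣y prime[3] 3∤k (3∣gap {t = t} 1≤i) (∣-trans (n∣m*n 2) 2k∣gap)))
    where
    3∣gap : ∀ {i t} → 1 ≤ i → 3 ∣ 2 * 3 ^ i * repunit 9 t
    3∣gap {suc i} {t} _ = ∣m⇒∣m*n (repunit 9 t) (∣n⇒∣m*n 2 (m∣m*n (3 ^ i)))

  -- x (2 + 2s) = x 2 + 18 R s, so two indices with R s ≡ R s′ (mod l) have a gap divisible by 9l.
  incongruent-9*⇒≤ : ∀ {n} l .{{_ : NonZero l}} K → 2 * K ≤ n → Incongruent x n (9 * l) → K ≤ l
  incongruent-9*⇒≤ {n} l K 2K≤n incongruent = ≮⇒≥ λ l<K →
    let s , s′ , s<s′ , s′<K , Rs≡Rs′ = pigeonhole-% l R l<K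
    in incongruent (2 + 2 * s) (2 + 2 * s′) (s≤s z≤n) (+-monoʳ-< 2 (*-monoʳ-< 2 s<s′)) (2+2s′≤n s′<K)
         (subst (9 * l ∣_) (sym (∣gap∣≡ s<s′)) (*-monoʳ-∣ 9 (∣n⇒∣m*n 2 (%≡%⇒∣∸ l Rs≡Rs′))))
    where
    R : ℕ → ℕ
    R = repunit 9
    2+2s′≤n : ∀ {s′} → s′ < K → 2 + 2 * s′ ≤ n
    2+2s′≤n {s′} s′<K = ≤-trans (≤-reflexive (sym (*-suc 2 s′))) (≤-trans (*-monoʳ-≤ 2 s′<K) 2K≤n)
    ∣gap∣≡ : ∀ {s s′} → s < s′ → ∣ x (2 + 2 * s) ℤ.- x (2 + 2 * s′) ∣ ≡ 9 * (2 * (R s′ ∸ R s))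
    ∣gap∣≡ {s} {s′} s<s′ = begin
      ∣ x (2 + 2 * s) ℤ.- x (2 + 2 * s′) ∣                   ≡⟨ cong₂ (λ a b → ∣ a ℤ.- b ∣) (x[i+2t]≡x[i]+2*3^i*R[t] 2 s) (x[i+2t]≡x[i]+2*3^i*R[t] 2 s′) ⟩
      ∣ (x 2 ℤ.+ + (18 * R s)) ℤ.- (x 2 ℤ.+ + (18 * R s′)) ∣ ≡⟨ cong ∣_∣ (cancel (x 2) (+ (18 * R s)) (+ (18 * R s′))) ⟩
      ∣ + (18 * R s) ℤ.- + (18 * R s′) ∣                     ≡⟨ cong ∣_∣ (ℤ.[+m]-[+n]≡m⊖n (18 * R s) (18 * R s′)) ⟩
      ∣ 18 * R s ℤ.⊖ 18 * R s′ ∣                             ≡⟨ ℤ.∣⊖∣-≤ (*-monoʳ-≤ 18 (repunit-mono-≤ 9 (<⇒≤ s<s′))) ⟩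
      18 * R s′ ∸ 18 * R s                                   ≡⟨ *-distribˡ-∸ 18 (R s′) (R s) ⟨
      18 * (R s′ ∸ R s)                                      ≡⟨ *-assoc 9 2 (R s′ ∸ R s) ⟩
      9 * (2 * (R s′ ∸ R s))                                 ∎
      where
      open ≡-Reasoning
      cancel : ∀ a m n → (a ℤ.+ m) ℤ.- (a ℤ.+ n) ≡ m ℤ.- n
      cancel = ℤ.solve-∀

  least-incongruent-modulus-¬3∣ : ∀ {n m} → 1 ≤ n → 1 ≤ m → Incongruent x n m →
                                  (∀ k → 1 ≤ k → Incongruent x n k → m ≤ k) → ¬ 3 ∣ m
  least-incongruent-modulus-¬3∣ {suc n} _ 1≤m incongruent least (divides k refl) with 3 ∣? k
  ... | no 3∤k = <⇒≱ 2k<3k (least (2 * k) 1≤2k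
                   (incongruent-3*⇒incongruent-2* 3∤k (subst (Incongruent x (suc n)) (*-comm k 3) incongruent)))
    where
    instance
      k≢0 : NonZero k
      k≢0 = m*n≢0⇒m≢0 k {{>-nonZero 1≤m}}
    1≤2k : 1 ≤ 2 * k
    1≤2k = ≤-trans (>-nonZero⁻¹ k) (m≤n*m k 2)
    2k<3k : 2 * k < k * 3
    2k<3k = subst (2 * k <_) (*-comm 3 k) (*-monoˡ-< k (≤-refl {3}))
  ... | yes (divides l refl) with power-of-two-between n | halve (suc n)
  ...   | b , 1+n≤2^[1+b] , 2^b≤1+n | h , 2h≤1+n , 1+n≤1+2h = <⇒≱ (2[1+2l]<9l l) (begin
    9 * l               ≡⟨ l*3*3≡9l ⟨
    l * 3 * 3           ≤⟨ least (2 * 2 ^ b) (≤-trans (s≤s z≤n) 1+n≤2^[1+b]) (incongruent-2*2^b b 1+n≤2^[1+b]) ⟩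
    2 * 2 ^ b           ≤⟨ *-monoʳ-≤ 2 2^b≤1+n ⟩
    2 * suc n           ≤⟨ *-monoʳ-≤ 2 1+n≤1+2h ⟩
    2 * (1 + 2 * h)     ≤⟨ *-monoʳ-≤ 2 (+-monoʳ-≤ 1 (*-monoʳ-≤ 2 h≤l)) ⟩
    2 * (1 + 2 * l)     ∎)
    where
    open ≤-Reasoning
    instance
      l≢0 : NonZero l
      l≢0 = m*n≢0⇒m≢0 l {{m*n≢0⇒m≢0 (l * 3) {{>-nonZero 1≤m}}}}
    l*3*3≡9l : l * 3 * 3 ≡ 9 * l
    l*3*3≡9l = trans (*-assoc l 3 3) (*-comm l 9)
    h≤l : h ≤ l
    h≤l = incongruent-9*⇒≤ l h 2h≤1+n (subst (Incongruent x (suc n)) l*3*3≡9l incongruent)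

4∣3^j-[-1]^j : ∀ j → + 4 ℤˢ.∣ (+ 3) ℤ.^ j ℤ.- (ℤ.- 1ℤ) ℤ.^ j
4∣3^j-[-1]^j zero    = ℤˢ.divides (+ 0) refl
4∣3^j-[-1]^j (suc j) = subst (+ 4 ℤˢ.∣_) (regroup ((+ 3) ℤ.^ j) ((ℤ.- 1ℤ) ℤ.^ j))
  (ℤˢ.∣m∣n⇒∣m+n (ℤˢ.∣n⇒∣m*n (+ 3) (4∣3^j-[-1]^j j)) (ℤˢ.∣m⇒∣m*n ((ℤ.- 1ℤ) ℤ.^ j) ℤˢ.∣-refl))
  where
  regroup : ∀ P E → + 3 ℤ.* (P ℤ.- E) ℤ.+ + 4 ℤ.* E ≡ + 3 ℤ.* P ℤ.- (ℤ.- 1ℤ) ℤ.* E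
  regroup = ℤ.solve-∀

[-1]^s*[1+2s]≡1-mod-4 : ∀ s → + 4 ℤˢ.∣ (ℤ.- 1ℤ) ℤ.^ s ℤ.* + (1 + 2 * s) ℤ.- 1ℤ
[-1]^s*[1+2s]≡1-mod-4 zero          = ℤˢ.divides (+ 0) refl
[-1]^s*[1+2s]≡1-mod-4 (suc zero)    = ℤˢ.divides (ℤ.- 1ℤ) refl
[-1]^s*[1+2s]≡1-mod-4 (suc (suc s)) = subst (+ 4 ℤˢ.∣_) (sym eq)
  (ℤˢ.∣m∣n⇒∣m+n ([-1]^s*[1+2s]≡1-mod-4 s) (ℤˢ.∣n⇒∣m*n ((ℤ.- 1ℤ) ℤ.^ s) ℤˢ.∣-refl))
  where
  E : ℤ
  E = (ℤ.- 1ℤ) ℤ.^ s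
  N : ℤ
  N = + (1 + 2 * s)
  eq : (ℤ.- 1ℤ) ℤ.^ (2 + s) ℤ.* + (1 + 2 * (2 + s)) ℤ.- 1ℤ ≡ (E ℤ.* N ℤ.- 1ℤ) ℤ.+ E ℤ.* + 4
  eq = begin
    (ℤ.- 1ℤ) ℤ.^ (2 + s) ℤ.* + (1 + 2 * (2 + s)) ℤ.- 1ℤ ≡⟨ cong (λ k → (ℤ.- 1ℤ) ℤ.^ (2 + s) ℤ.* + k ℤ.- 1ℤ) (shift s) ⟩
    (ℤ.- 1ℤ) ℤ.^ (2 + s) ℤ.* + (1 + 2 * s + 4) ℤ.- 1ℤ   ≡⟨ cong (λ k → (ℤ.- 1ℤ) ℤ.^ (2 + s) ℤ.* k ℤ.- 1ℤ) (ℤ.pos-+ (1 + 2 * s) 4) ⟩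
    (ℤ.- 1ℤ) ℤ.* ((ℤ.- 1ℤ) ℤ.* E) ℤ.* (N ℤ.+ + 4) ℤ.- 1ℤ ≡⟨ ring E N ⟩
    (E ℤ.* N ℤ.- 1ℤ) ℤ.+ E ℤ.* + 4                      ∎
    where
    open ≡-Reasoning
    shift : ∀ s → 1 + 2 * (2 + s) ≡ 1 + 2 * s + 4
    shift = solve-∀
    ring : ∀ E N → (ℤ.- 1ℤ) ℤ.* ((ℤ.- 1ℤ) ℤ.* E) ℤ.* (N ℤ.+ + 4) ℤ.- 1ℤ ≡ (E ℤ.* N ℤ.- 1ℤ) ℤ.+ E ℤ.* + 4
    ring = ℤ.solve-∀

qStar≡1-mod-4 : ∀ {q} → ¬ 2 ∣ q → + 4 ℤˢ.∣ qStar q ℤ.- 1ℤ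
qStar≡1-mod-4 {q} 2∤q with even-or-odd q
... | h , inj₁ refl = contradiction (m∣m*n h) 2∤q
... | h , inj₂ refl = subst (λ k → + 4 ℤˢ.∣ (ℤ.- 1ℤ) ℤ.^ k ℤ.* + (1 + 2 * h) ℤ.- 1ℤ) (sym 2h/2≡h) ([-1]^s*[1+2s]≡1-mod-4 h)
  where
  2h/2≡h : 2 * h / 2 ≡ h
  2h/2≡h = trans (cong (_/ 2) (*-comm 2 h)) (m*n/n≡m h 2)

module _ {q : ℕ} (qStar≡1 : + 4 ℤˢ.∣ qStar q ℤ.- 1ℤ) where

  private
    e : ℕ → ℤ
    e j = (ℤ.- 1ℤ) ℤ.^ j

  u*4≡3^j-qStar*[-1]^j : ∀ j → u q j ℤ.* + 4 ≡ (+ 3) ℤ.^ j ℤ.- qStar q ℤ.* e j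
  u*4≡3^j-qStar*[-1]^j j = [i/ℕn]*n≡i 4 (subst (+ 4 ℤˢ.∣_) (regroup ((+ 3) ℤ.^ j) (qStar q) (e j))
    (ℤˢ.∣m∣n⇒∣m-n (4∣3^j-[-1]^j j) (ℤˢ.∣m⇒∣m*n (e j) qStar≡1)))
    where
    regroup : ∀ P Q E → (P ℤ.- E) ℤ.- (Q ℤ.- 1ℤ) ℤ.* E ≡ P ℤ.- Q ℤ.* E
    regroup = ℤ.solve-∀

  u-step : ∀ j → u q j ℤ.+ u q (suc j) ≡ + (3 ^ j)
  u-step j = ℤ.*-cancelʳ-≡ _ _ (+ 4) (begin
    (u q j ℤ.+ u q (suc j)) ℤ.* + 4                   ≡⟨ ℤ.*-distribʳ-+ (+ 4) (u q j) (u q (suc j)) ⟩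
    u q j ℤ.* + 4 ℤ.+ u q (suc j) ℤ.* + 4             ≡⟨ cong₂ ℤ._+_ (u*4≡3^j-qStar*[-1]^j j) (u*4≡3^j-qStar*[-1]^j (suc j)) ⟩
    (P ℤ.- Q ℤ.* e j) ℤ.+ (+ 3 ℤ.* P ℤ.- Q ℤ.* ((ℤ.- 1ℤ) ℤ.* e j)) ≡⟨ telescope P Q (e j) ⟩
    P ℤ.* + 4                                         ≡⟨ cong (ℤ._* + 4) (pos-^ 3 j) ⟨
    + (3 ^ j) ℤ.* + 4                                 ∎)
    where
    open ≡-Reasoning
    P : ℤ
    P = (+ 3) ℤ.^ j
    Q : ℤ
    Q = qStar q
    telescope : ∀ P Q E → (P ℤ.- Q ℤ.* E) ℤ.+ (+ 3 ℤ.* P ℤ.- Q ℤ.* ((ℤ.- 1ℤ) ℤ.* E)) ≡ P ℤ.* + 4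
    telescope = ℤ.solve-∀

lemma11 : (q : ℕ) → Prime q → 5 ≤ q → (n : ℕ) → 1 ≤ n → (m : ℕ) → IsD q n m → ¬ (3 ∣ m)
lemma11 q q-prime 5≤q n 1≤n m (1≤m , separates , least) =
  least-incongruent-modulus-¬3∣ {x = u q} (u-step {q} (qStar≡1-mod-4 2∤q)) 1≤n 1≤m separates least
  where
  2∤q : ¬ 2 ∣ q
  2∤q 2∣q = Prime.notComposite q-prime (composite (≤-trans (m≤m+n 3 2) 5≤q) 2∣q)
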